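{- Let $(A,B)$ be a partition of $[n]$ and let $S\subseteq\binom{A}{2}$, $T\subseteq\binom{B}{2}$ be such that the graph $S\cup T$ is triangle-free. Let $\mathcal{G}(S,T)$ be the set of triangle-free graphs $G$ on $[n]$ with $G[A]=S$ and $G[B]=T$. Then for every $\lambda$, \[\sum_{G\in\mathcal{G}(S,T)}\lambda^{|G|}=\lambda^{|S|+|T|}\,Z_{S\square T}(\lambda).\]
   Context: Graphs are identified with their edge sets and $|G|$ is the number of edges. For $S\subseteq\binom A2$, $T\subseteq\binom B2$, the graph $S\square T$ (Cartesian product of $(A,S)$ and $(B,T)$) has vertex set $A\times B$ and edge set $\{\{(a,b),(a,b')\}:\{b,b'\}\in T\}\cup\{\{(a,b),(a',b)\}:\{a,a'\}\in S\}$. For a graph $H$, $Z_H(\lambda)=\sum_{I}\lambda^{|I|}$, the sum over all independent sets $I$ of $H$ (the hard-core partition function). -}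

module Defs where

open import Level using (Level)
open import Data.Bool using (Bool; true; false; _∧_; _∨_; not; _xor_; if_then_else_)
open import Data.Nat using (ℕ; zero; suc; _<ᵇ_) renaming (_+_ to _+ℕ_)
open import Data.Fin using (Fin; zero; suc; toℕ)
open import Data.List using (List; []; _∷_; [_]; map; concatMap; foldr; allFin)
open import Data.Bool.ListAction using (and)
open import Data.Nat.ListAction using (sum)
open import Algebra.Bundles using (CommutativeSemiring)

-- A (simple) graph on vertex set [n] = Fin n, given by its adjacency
-- function; it is a graph iff this is symmetric and irreflexive.
Graph : ℕ → Set
Graph n = Fin n → Fin n → Bool

allB : ∀ {n} → (Fin n → Bool) → Bool
allB {n} p = and (map p (allFin n))

funs : ∀ {X : Set} (k : ℕ) → List X → List (Fin k → X)
funs zero    xs = [ (λ ()) ]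
funs (suc k) xs = concatMap (λ x → map (λ f → λ { zero → x ; (suc i) → f i }) (funs k xs)) xs

bools : List Bool
bools = true ∷ false ∷ []

allMatrices : (n : ℕ) → List (Fin n → Fin n → Bool)
allMatrices n = funs n (funs n bools)

isGraphᵇ : ∀ {n} → Graph n → Bool
isGraphᵇ G = allB λ i → allB λ j → not (G i j xor G j i) ∧ not (G i i)

_∪_ : ∀ {n} → Graph n → Graph n → Graph n
(G ∪ H) i j = G i j ∨ H i j

triangleFreeᵇ : ∀ {n} → Graph n → Bool
triangleFreeᵇ G = allB λ i → allB λ j → allB λ k → not (G i j ∧ G j k ∧ G i k)

edgeCount : ∀ {n} → Graph n → ℕ
edgeCount {n} G = sum (map (λ i → sum (map (λ j → if (toℕ i <ᵇ toℕ j) ∧ G i j then 1 else 0) (allFin n))) (allFin n))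

inducedEqᵇ : ∀ {n} → (Fin n → Bool) → Graph n → Graph n → Bool
inducedEqᵇ A G S = allB λ i → allB λ j → not (A i ∧ A j) ∨ not (G i j xor S i j)

-- Subsets of A × B ⊆ [n] × [n], where B = complement of A, represented as
-- I : Fin n → Fin n → Bool with I a b = true iff (a,b) ∈ I.
inABᵇ : ∀ {n} → (Fin n → Bool) → (Fin n → Fin n → Bool) → Bool
inABᵇ A I = allB λ a → allB λ b → not (I a b) ∨ (A a ∧ not (A b))

independentBoxᵇ : ∀ {n} → Graph n → Graph n → (Fin n → Fin n → Bool) → Bool
independentBoxᵇ S T I =
  (allB λ a → allB λ b → allB λ b' → not (I a b ∧ I a b' ∧ T b b'))
  ∧ (allB λ a → allB λ a' → allB λ b → not (I a b ∧ I a' b ∧ S a a'))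

setSize : ∀ {n} → (Fin n → Fin n → Bool) → ℕ
setSize {n} I = sum (map (λ a → sum (map (λ b → if I a b then 1 else 0) (allFin n))) (allFin n))

module _ {c ℓ : Level} (R : CommutativeSemiring c ℓ) where
  open CommutativeSemiring R

  pow : Carrier → ℕ → Carrier
  pow x zero    = 1#
  pow x (suc k) = x * pow x k

  sumWhere : ∀ {X : Set} → List X → (X → Bool) → (X → Carrier) → Carrier
  sumWhere xs p f = foldr (λ x acc → (if p x then f x else 0#) + acc) 0# xs

  graphSum : ∀ {n} → (Fin n → Bool) → Graph n → Graph n → Carrier → Carrier
  graphSum {n} A S T lam =
    sumWhere (allMatrices n)
      (λ G → isGraphᵇ G ∧ triangleFreeᵇ G ∧ inducedEqᵇ A G S ∧ inducedEqᵇ (λ i → not (A i)) G T)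
      (λ G → pow lam (edgeCount G))

  Zbox : ∀ {n} → (Fin n → Bool) → Graph n → Graph n → Carrier → Carrier
  Zbox {n} A S T lam =
    sumWhere (allMatrices n) (λ I → inABᵇ A I ∧ independentBoxᵇ S T I) (λ I → pow lam (setSize I))

-- Write I ⊆ A × B for an independent set of S □ T. Gluing I onto S ∪ T (each pair (a, b) ∈ I
-- becoming the edge ab) gives a graph of 𝒢(S,T) with |S| + |T| + |I| edges: a triangle of the
-- glued graph lies inside A or inside B, where it is a triangle of S or of T, or it has two
-- vertices on one side, and then its two cross edges are pairs of I adjacent in S □ T. Conversely
-- every G ∈ 𝒢(S,T) is the gluing of its crossing edges G ∩ (A × B), which form an independent set
-- of S □ T because G is triangle-free. Both sums range over all Boolean matrices, so this
-- bijection is applied as a change of variables: insert the Kronecker delta of the bijection's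
-- graph and exchange the two sums.
module Submission where

open import Level using (Level; _⊔_)
open import Defs
open import Algebra.Bundles using (CommutativeSemiring)
open import Data.Bool using (Bool; true; false; not; _∧_; _∨_; _xor_; if_then_else_)
open import Data.Bool.Properties using (∨-comm; ∨-identityʳ; not-injective; not-¬; ¬-not)
open import Data.Bool.ListAction using (and)
open import Data.Empty using (⊥; ⊥-elim)
open import Data.Fin using (Fin; zero; suc; toℕ)
open import Data.Fin.Properties using (toℕ-injective)
open import Data.List using (List; []; _∷_; map; concatMap; foldr; allFin; _++_)
open import Data.List.Properties using (map-tabulate; map-cong; foldr-map)
open import Data.Nat using (ℕ; zero; suc; _<ᵇ_) renaming (_+_ to _+ℕ_; _*_ to _*ℕ_)
open import Data.Nat.ListAction using (sum)
import Data.Nat.Properties as ℕₚ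
open import Data.Product using (_×_; _,_; proj₁; proj₂)
open import Data.Sum using (_⊎_; inj₁; inj₂)
open import Data.Vec.Functional using (head; tail) renaming (_∷_ to _◂_)
open import Function using (_∘_; id)
open import Relation.Binary.PropositionalEquality
  using (_≡_; _≢_; refl; sym; trans; cong; cong₂; module ≡-Reasoning)

-- The form in which Defs compares Booleans.
_==_ : Bool → Bool → Bool
a == b = not (a xor b)

==-refl : ∀ a → a == a ≡ true
==-refl true  = refl
==-refl false = refl

==⇒≡ : ∀ {a b} → a == b ≡ true → a ≡ b
==⇒≡ {true}  {true}  _ = refl
==⇒≡ {false} {false} _ = refl

≡⇒== : ∀ {a b} → a ≡ b → a == b ≡ true
≡⇒== {a} refl = ==-refl a

true⇔true⇒≡ : ∀ {a b} → (a ≡ true → b ≡ true) → (b ≡ true → a ≡ true) → a ≡ b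
true⇔true⇒≡ {true}          to _    = sym (to refl)
true⇔true⇒≡ {false} {true}  _  from = from refl
true⇔true⇒≡ {false} {false} _  _    = refl

∧-true⁻ : ∀ {a b} → a ∧ b ≡ true → a ≡ true × b ≡ true
∧-true⁻ {true} e = refl , e

∧-true⁺ : ∀ {a b} → a ≡ true → b ≡ true → a ∧ b ≡ true
∧-true⁺ refl e = e

not-∨⁻ : ∀ {a b} → not a ∨ b ≡ true → a ≡ true → b ≡ true
not-∨⁻ e refl = e

not-∨⁺ : ∀ {a b} → (a ≡ true → b ≡ true) → not a ∨ b ≡ true
not-∨⁺ {true}  f = f refl
not-∨⁺ {false} _ = refl

nand³⁻ : ∀ {x y z} → not (x ∧ y ∧ z) ≡ true → x ≡ true → y ≡ true → z ≡ true → ⊥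
nand³⁻ () refl refl refl

nand³⁺ : ∀ {x y z} → (x ≡ true → y ≡ true → z ≡ true → ⊥) → not (x ∧ y ∧ z) ≡ true
nand³⁺ {true}  {true}  {true}  f = ⊥-elim (f refl refl refl)
nand³⁺ {true}  {true}  {false} _ = refl
nand³⁺ {true}  {false}         _ = refl
nand³⁺ {false}                 _ = refl

allB-suc : ∀ {n} (p : Fin (suc n) → Bool) → allB p ≡ p zero ∧ allB (p ∘ suc)
allB-suc p = cong (λ xs → p zero ∧ and xs)
  (trans (map-tabulate suc p) (sym (map-tabulate id (p ∘ suc))))

allB-cong : ∀ {n} {p q : Fin n → Bool} → (∀ i → p i ≡ q i) → allB p ≡ allB q
allB-cong {n} h = cong and (map-cong h (allFin n))

allB⁻ : ∀ {n} (p : Fin n → Bool) → allB p ≡ true → ∀ i → p i ≡ true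
allB⁻ p e zero    = proj₁ (∧-true⁻ (trans (sym (allB-suc p)) e))
allB⁻ p e (suc i) = allB⁻ (p ∘ suc) (proj₂ (∧-true⁻ (trans (sym (allB-suc p)) e))) i

allB⁺ : ∀ {n} (p : Fin n → Bool) → (∀ i → p i ≡ true) → allB p ≡ true
allB⁺ {zero}  p h = refl
allB⁺ {suc n} p h = trans (allB-suc p) (∧-true⁺ (h zero) (allB⁺ (p ∘ suc) (h ∘ suc)))

allB²⁻ : ∀ {n} (p : Fin n → Fin n → Bool) → allB (λ i → allB (p i)) ≡ true → ∀ i j → p i j ≡ true
allB²⁻ p e i = allB⁻ (p i) (allB⁻ _ e i)

allB²⁺ : ∀ {n} (p : Fin n → Fin n → Bool) → (∀ i j → p i j ≡ true) → allB (λ i → allB (p i)) ≡ true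
allB²⁺ p h = allB⁺ _ (λ i → allB⁺ (p i) (h i))

allB³⁻ : ∀ {n} (p : Fin n → Fin n → Fin n → Bool)
  → allB (λ i → allB (λ j → allB (p i j))) ≡ true → ∀ i j k → p i j k ≡ true
allB³⁻ p e i j = allB⁻ (p i j) (allB²⁻ _ e i j)

allB³⁺ : ∀ {n} (p : Fin n → Fin n → Fin n → Bool)
  → (∀ i j k → p i j k ≡ true) → allB (λ i → allB (λ j → allB (p i j))) ≡ true
allB³⁺ p h = allB²⁺ _ (λ i j → allB⁺ (p i j) (h i j))

pointwise : ∀ {X : Set} {k} → (X → X → Bool) → (Fin k → X) → (Fin k → X) → Bool
pointwise _≈ᵇ_ f g = allB λ i → f i ≈ᵇ g i

pointwise-refl : ∀ {X : Set} {k} (_≈ᵇ_ : X → X → Bool)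
  → (∀ x → x ≈ᵇ x ≡ true) → (f : Fin k → X) → pointwise _≈ᵇ_ f f ≡ true
pointwise-refl _ r f = allB⁺ _ (λ i → r (f i))

_≐_ : ∀ {n} → Graph n → Graph n → Bool
_≐_ = pointwise (pointwise _==_)

≐⁻ : ∀ {n} {G H : Graph n} → G ≐ H ≡ true → ∀ i j → G i j ≡ H i j
≐⁻ e i j = ==⇒≡ (allB²⁻ _ e i j)

≐⁺ : ∀ {n} {G H : Graph n} → (∀ i j → G i j ≡ H i j) → G ≐ H ≡ true
≐⁺ h = allB²⁺ _ (λ i j → ≡⇒== (h i j))

module Sums {c ℓ : Level} (R : CommutativeSemiring c ℓ) where
  open CommutativeSemiring R hiding (zero) renaming (refl to ≈-refl; sym to ≈-sym; trans to ≈-trans)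
  open import Algebra.Properties.CommutativeSemigroup +-commutativeSemigroup using (interchange)
  open import Relation.Binary.Reasoning.Setoid setoid

  Σ : ∀ {X : Set} → List X → (X → Carrier) → Carrier
  Σ xs f = foldr (λ x acc → f x + acc) 0# xs

  infix 5 _when_
  _when_ : Carrier → Bool → Carrier
  x when b = if b then x else 0#

  Σ-cong : ∀ {X : Set} (xs : List X) {f g : X → Carrier} → (∀ x → f x ≈ g x) → Σ xs f ≈ Σ xs g
  Σ-cong []       _ = ≈-refl
  Σ-cong (x ∷ xs) e = +-cong (e x) (Σ-cong xs e)

  Σ-0# : ∀ {X : Set} (xs : List X) → Σ xs (λ _ → 0#) ≈ 0#
  Σ-0# []       = ≈-refl
  Σ-0# (x ∷ xs) = ≈-trans (+-identityˡ _) (Σ-0# xs)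

  Σ-+ : ∀ {X : Set} (xs : List X) (f g : X → Carrier) → Σ xs (λ x → f x + g x) ≈ Σ xs f + Σ xs g
  Σ-+ []       f g = ≈-sym (+-identityˡ 0#)
  Σ-+ (x ∷ xs) f g = ≈-trans (+-congˡ (Σ-+ xs f g)) (interchange _ _ _ _)

  Σ-*ˡ : ∀ {X : Set} (xs : List X) (k : Carrier) (f : X → Carrier) → k * Σ xs f ≈ Σ xs (λ x → k * f x)
  Σ-*ˡ []       k f = zeroʳ k
  Σ-*ˡ (x ∷ xs) k f = ≈-trans (distribˡ k _ _) (+-congˡ (Σ-*ˡ xs k f))

  Σ-swap : ∀ {X Y : Set} (xs : List X) (ys : List Y) (f : X → Y → Carrier)
    → Σ xs (λ x → Σ ys (f x)) ≈ Σ ys (λ y → Σ xs (λ x → f x y))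
  Σ-swap []       ys f = ≈-sym (Σ-0# ys)
  Σ-swap (x ∷ xs) ys f = ≈-trans (+-congˡ (Σ-swap xs ys f)) (≈-sym (Σ-+ ys (f x) _))

  Σ-++ : ∀ {X : Set} (xs ys : List X) (f : X → Carrier) → Σ (xs ++ ys) f ≈ Σ xs f + Σ ys f
  Σ-++ []       ys f = ≈-sym (+-identityˡ _)
  Σ-++ (x ∷ xs) ys f = ≈-trans (+-congˡ (Σ-++ xs ys f)) (≈-sym (+-assoc _ _ _))

  Σ-map : ∀ {X Y : Set} (g : X → Y) (xs : List X) (f : Y → Carrier) → Σ (map g xs) f ≈ Σ xs (f ∘ g)
  Σ-map g []       f = ≈-refl
  Σ-map g (x ∷ xs) f = +-congˡ (Σ-map g xs f)

  Σ-concatMap : ∀ {X Y : Set} (g : X → List Y) (xs : List X) (f : Y → Carrier)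
    → Σ (concatMap g xs) f ≈ Σ xs (λ x → Σ (g x) f)
  Σ-concatMap g []       f = ≈-refl
  Σ-concatMap g (x ∷ xs) f = ≈-trans (Σ-++ (g x) (concatMap g xs) f) (+-congˡ (Σ-concatMap g xs f))

  when-cong : ∀ b {x y} → x ≈ y → x when b ≈ y when b
  when-cong true  e = e
  when-cong false _ = ≈-refl

  when-∧ : ∀ a b x → x when (a ∧ b) ≡ (x when b) when a
  when-∧ true  b x = refl
  when-∧ false b x = refl

  *-when : ∀ b k x → k * (x when b) ≈ (k * x) when b
  *-when true  k x = ≈-refl
  *-when false k x = zeroʳ k

  Σ-when : ∀ {X : Set} (xs : List X) (b : Bool) (f : X → Carrier) → Σ xs (λ x → f x when b) ≈ Σ xs f when b
  Σ-when xs true  f = ≈-refl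
  Σ-when xs false f = Σ-0# xs

  Σ-when-cong : ∀ {X : Set} (xs : List X) (p : X → Bool) {f g : X → Carrier}
    → (∀ x → p x ≡ true → f x ≈ g x) → Σ xs (λ x → f x when p x) ≈ Σ xs (λ x → g x when p x)
  Σ-when-cong xs p {f} {g} e = Σ-cong xs pointwise-when
    where
    pointwise-when : ∀ x → f x when p x ≈ g x when p x
    pointwise-when x with p x in px
    ... | true  = e x px
    ... | false = ≈-refl

  pow-+ : ∀ x m n → pow R x (m +ℕ n) ≈ pow R x m * pow R x n
  pow-+ x zero    n = ≈-sym (*-identityˡ _)
  pow-+ x (suc m) n = ≈-trans (*-congˡ (pow-+ x m n)) (≈-sym (*-assoc _ _ _))

  -- xs meets every ≈ᵇ-class exactly once.
  record IsEnumeration {X : Set} (xs : List X) (_≈ᵇ_ : X → X → Bool) : Set (c ⊔ ℓ) where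
    field
      Σ-select : ∀ (h : X → Carrier) → (∀ {x x'} → x ≈ᵇ x' ≡ true → h x ≈ h x')
        → ∀ y → Σ xs (λ x → h x when (x ≈ᵇ y)) ≈ h y
  open IsEnumeration

  bools-enumeration : IsEnumeration bools _==_
  Σ-select bools-enumeration h _ true  = ≈-trans (+-congˡ (+-identityˡ 0#)) (+-identityʳ _)
  Σ-select bools-enumeration h _ false = ≈-trans (+-identityˡ _) (+-identityʳ _)

  singleton-enumeration : ∀ {X : Set} {x : X} {_≈ᵇ_ : X → X → Bool}
    → (∀ y y' → y ≈ᵇ y' ≡ true) → IsEnumeration (x ∷ []) _≈ᵇ_
  Σ-select (singleton-enumeration {x = x} all-equivalent) h h-resp y rewrite all-equivalent x y =
    ≈-trans (+-identityʳ (h x)) (h-resp (all-equivalent x y))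

  -- cons is abstract because funs builds its tuples with an anonymous pattern lambda.
  cons-enumeration : ∀ {X : Set} {k} {xs : List X} {fs : List (Fin k → X)} {_≈ᵇ_ : X → X → Bool}
    → (∀ x → x ≈ᵇ x ≡ true) → IsEnumeration xs _≈ᵇ_ → IsEnumeration fs (pointwise _≈ᵇ_)
    → (cons : X → (Fin k → X) → Fin (suc k) → X) → (∀ x f i → cons x f i ≡ (x ◂ f) i)
    → IsEnumeration (concatMap (λ x → map (cons x) fs) xs) (pointwise _≈ᵇ_)
  Σ-select (cons-enumeration {xs = xs} {fs} {_≈ᵇ_} ≈ᵇ-refl xs-enum fs-enum cons cons≗◂) h h-resp y = begin
    Σ (concatMap (λ x → map (cons x) fs) xs) (λ f → h f when (f ≐ᵇ y))
      ≈⟨ Σ-concatMap _ xs _ ⟩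
    Σ xs (λ x → Σ (map (cons x) fs) (λ f → h f when (f ≐ᵇ y)))
      ≈⟨ Σ-cong xs (λ x → ≈-trans (Σ-map (cons x) fs _) (Σ-cong fs (cons→◂ x))) ⟩
    Σ xs (λ x → Σ fs (λ f → h (x ◂ f) when ((x ◂ f) ≐ᵇ y)))
      ≈⟨ Σ-cong xs (λ x → Σ-cong fs (λ f → reflexive (split-test x f))) ⟩
    Σ xs (λ x → Σ fs (λ f → (h (x ◂ f) when (f ≐ᵇ tail y)) when (x ≈ᵇ head y)))
      ≈⟨ Σ-cong xs (λ x → Σ-when fs (x ≈ᵇ head y) _) ⟩
    Σ xs (λ x → Σ fs (λ f → h (x ◂ f) when (f ≐ᵇ tail y)) when (x ≈ᵇ head y))
      ≈⟨ Σ-cong xs (λ x → when-cong (x ≈ᵇ head y)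
           (Σ-select fs-enum (h ∘ (x ◂_)) (λ {f} {f'} e → h-resp (◂-resp-tail x f f' e)) (tail y))) ⟩
    Σ xs (λ x → h (x ◂ tail y) when (x ≈ᵇ head y))
      ≈⟨ Σ-select xs-enum (λ x → h (x ◂ tail y)) (λ {x} {x'} e → h-resp (◂-resp-head x x' e)) (head y) ⟩
    h (head y ◂ tail y)
      ≈⟨ h-resp (allB⁺ _ (λ { zero → ≈ᵇ-refl (y zero) ; (suc i) → ≈ᵇ-refl (y (suc i)) })) ⟩
    h y ∎
    where
    _≐ᵇ_ : ∀ {m} → (Fin m → _) → (Fin m → _) → Bool
    _≐ᵇ_ = pointwise _≈ᵇ_
    ◂-≐ᵇ : ∀ x f (g : Fin (suc _) → _) → (x ◂ f) ≐ᵇ g ≡ (x ≈ᵇ head g) ∧ (f ≐ᵇ tail g)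
    ◂-≐ᵇ x f g = allB-suc (λ i → (x ◂ f) i ≈ᵇ g i)
    split-test : ∀ x f
      → h (x ◂ f) when ((x ◂ f) ≐ᵇ y) ≡ (h (x ◂ f) when (f ≐ᵇ tail y)) when (x ≈ᵇ head y)
    split-test x f =
      trans (cong (h (x ◂ f) when_) (◂-≐ᵇ x f y)) (when-∧ (x ≈ᵇ head y) (f ≐ᵇ tail y) (h (x ◂ f)))
    cons→◂ : ∀ x f → h (cons x f) when (cons x f ≐ᵇ y) ≈ h (x ◂ f) when ((x ◂ f) ≐ᵇ y)
    cons→◂ x f = ≈-trans
      (reflexive (cong (h (cons x f) when_) (allB-cong (λ i → cong (_≈ᵇ y i) (cons≗◂ x f i)))))
      (when-cong ((x ◂ f) ≐ᵇ y) (h-resp (allB⁺ _ (λ i → trans (cong (_≈ᵇ _) (cons≗◂ x f i)) (≈ᵇ-refl _)))))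
    ◂-resp-tail : ∀ x f f' → f ≐ᵇ f' ≡ true → (x ◂ f) ≐ᵇ (x ◂ f') ≡ true
    ◂-resp-tail x f f' e = trans (◂-≐ᵇ x f (x ◂ f')) (∧-true⁺ (≈ᵇ-refl x) e)
    ◂-resp-head : ∀ x x' → x ≈ᵇ x' ≡ true → (x ◂ tail y) ≐ᵇ (x' ◂ tail y) ≡ true
    ◂-resp-head x x' e =
      trans (◂-≐ᵇ x (tail y) (x' ◂ tail y)) (∧-true⁺ e (pointwise-refl _≈ᵇ_ ≈ᵇ-refl (tail y)))

  funs-enumeration : ∀ {X : Set} {xs : List X} {_≈ᵇ_ : X → X → Bool}
    → (∀ x → x ≈ᵇ x ≡ true) → IsEnumeration xs _≈ᵇ_
    → ∀ k → IsEnumeration (funs k xs) (pointwise _≈ᵇ_)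
  funs-enumeration ≈ᵇ-refl enum zero = singleton-enumeration (λ _ _ → refl)
  funs-enumeration {xs = xs} ≈ᵇ-refl enum (suc k) =
    cons-enumeration {xs = xs} {fs = funs k xs} ≈ᵇ-refl enum (funs-enumeration ≈ᵇ-refl enum k)
      _ (λ { x f zero → refl ; x f (suc i) → refl })

  matrices-enumeration : ∀ n → IsEnumeration (allMatrices n) _≐_
  matrices-enumeration n =
    funs-enumeration (pointwise-refl _==_ ==-refl) (funs-enumeration ==-refl bools-enumeration n) n

  -- The hypothesis on f and g says that they restrict to mutually inverse bijections between
  -- {x | p x} and {y | q y}, up to ≈X and ≈Y.
  Σ-reindex : ∀ {X Y : Set} {xs : List X} {ys : List Y} {_≈X_ : X → X → Bool} {_≈Y_ : Y → Y → Bool}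
    → IsEnumeration xs _≈X_ → IsEnumeration ys _≈Y_
    → (f : X → Y) (g : Y → X) (p : X → Bool) (q : Y → Bool)
    → (∀ x y → p x ∧ (y ≈Y f x) ≡ q y ∧ (x ≈X g y))
    → (w : Y → Carrier) → (∀ {y y'} → y ≈Y y' ≡ true → w y ≈ w y')
    → Σ ys (λ y → w y when q y) ≈ Σ xs (λ x → w (f x) when p x)
  Σ-reindex {xs = xs} {ys} {_≈X_} {_≈Y_} xs-enum ys-enum f g p q graph w w-resp = begin
    Σ ys (λ y → w y when q y)
      ≈⟨ Σ-cong ys (λ y → when-cong (q y) (≈-sym (Σ-select xs-enum (λ _ → w y) (λ _ → ≈-refl) (g y)))) ⟩
    Σ ys (λ y → Σ xs (λ x → w y when (x ≈X g y)) when q y)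
      ≈⟨ Σ-cong ys (λ y → ≈-sym (Σ-when xs (q y) _)) ⟩
    Σ ys (λ y → Σ xs (λ x → (w y when (x ≈X g y)) when q y))
      ≈⟨ Σ-cong ys (λ y → Σ-cong xs (λ x → reflexive (use-graph x y))) ⟩
    Σ ys (λ y → Σ xs (λ x → w y when (p x ∧ (y ≈Y f x))))
      ≈⟨ Σ-swap ys xs _ ⟩
    Σ xs (λ x → Σ ys (λ y → w y when (p x ∧ (y ≈Y f x))))
      ≈⟨ Σ-cong xs (λ x → ≈-trans (Σ-cong ys (λ y → reflexive (when-∧ (p x) (y ≈Y f x) (w y))))
                                 (Σ-when ys (p x) _)) ⟩
    Σ xs (λ x → Σ ys (λ y → w y when (y ≈Y f x)) when p x)
      ≈⟨ Σ-cong xs (λ x → when-cong (p x) (Σ-select ys-enum w w-resp (f x))) ⟩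
    Σ xs (λ x → w (f x) when p x) ∎
    where
    use-graph : ∀ x y → (w y when (x ≈X g y)) when q y ≡ w y when (p x ∧ (y ≈Y f x))
    use-graph x y = trans (sym (when-∧ (q y) (x ≈X g y) (w y))) (cong (w y when_) (sym (graph x y)))

module ℕΣ = Sums ℕₚ.+-*-commutativeSemiring

𝟙 : Bool → ℕ
𝟙 b = if b then 1 else 0

𝟙-∧ : ∀ a b → 𝟙 (a ∧ b) ≡ 𝟙 a *ℕ 𝟙 b
𝟙-∧ true  true  = refl
𝟙-∧ true  false = refl
𝟙-∧ false _     = refl

<ᵇ-exactly-one : ∀ m k → m ≢ k → 𝟙 (m <ᵇ k) +ℕ 𝟙 (k <ᵇ m) ≡ 1
<ᵇ-exactly-one zero    zero    m≢k = ⊥-elim (m≢k refl)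
<ᵇ-exactly-one zero    (suc k) _   = refl
<ᵇ-exactly-one (suc m) zero    _   = refl
<ᵇ-exactly-one (suc m) (suc k) m≢k = <ᵇ-exactly-one m k (m≢k ∘ cong suc)

module PairSums (n : ℕ) where
  open ℕΣ using (Σ; Σ-cong; Σ-+; Σ-swap)

  Σ² : (Fin n → Fin n → ℕ) → ℕ
  Σ² f = Σ (allFin n) (λ i → Σ (allFin n) (f i))

  Σ²-cong : ∀ {f g} → (∀ i j → f i j ≡ g i j) → Σ² f ≡ Σ² g
  Σ²-cong h = Σ-cong (allFin n) (λ i → Σ-cong (allFin n) (h i))

  Σ²-+ : ∀ f g → Σ² (λ i j → f i j +ℕ g i j) ≡ Σ² f +ℕ Σ² g
  Σ²-+ f g = trans (Σ-cong (allFin n) (λ i → Σ-+ (allFin n) (f i) (g i))) (Σ-+ (allFin n) _ _)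

  Σ²-transpose : ∀ f → Σ² f ≡ Σ² (λ i j → f j i)
  Σ²-transpose f = Σ-swap (allFin n) (allFin n) f

  sum∘map : ∀ {X : Set} (f : X → ℕ) (xs : List X) → sum (map f xs) ≡ Σ xs f
  sum∘map f xs = foldr-map _+ℕ_ f 0 xs

  upper : Fin n → Fin n → ℕ
  upper i j = 𝟙 (toℕ i <ᵇ toℕ j)

  sum²∘map : ∀ f → sum (map (λ i → sum (map (f i) (allFin n))) (allFin n)) ≡ Σ² f
  sum²∘map f = trans (cong sum (map-cong (λ i → sum∘map (f i) (allFin n)) (allFin n))) (sum∘map _ (allFin n))

  edgeCount-Σ² : ∀ G → edgeCount G ≡ Σ² (λ i j → upper i j *ℕ 𝟙 (G i j))
  edgeCount-Σ² G = trans (sum²∘map _) (Σ²-cong (λ i j → 𝟙-∧ (toℕ i <ᵇ toℕ j) (G i j)))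

  setSize-Σ² : ∀ I → setSize I ≡ Σ² (λ i j → 𝟙 (I i j))
  setSize-Σ² I = sum²∘map _

  edgeCount-cong : ∀ {G H} → (∀ i j → G i j ≡ H i j) → edgeCount G ≡ edgeCount H
  edgeCount-cong {G} {H} h = trans (edgeCount-Σ² G)
    (trans (Σ²-cong (λ i j → cong (λ b → upper i j *ℕ 𝟙 b) (h i j))) (sym (edgeCount-Σ² H)))

  -- Each off-diagonal pair is counted once above and once below the diagonal.
  upper+lower : ∀ I → (∀ i → I i i ≡ false)
    → Σ² (λ i j → upper i j *ℕ 𝟙 (I i j)) +ℕ Σ² (λ i j → upper i j *ℕ 𝟙 (I j i)) ≡ setSize I
  upper+lower I irr = begin
    Σ² (λ i j → upper i j *ℕ 𝟙 (I i j)) +ℕ Σ² (λ i j → upper i j *ℕ 𝟙 (I j i))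
      ≡⟨ cong (Σ² (λ i j → upper i j *ℕ 𝟙 (I i j)) +ℕ_) (Σ²-transpose _) ⟩
    Σ² (λ i j → upper i j *ℕ 𝟙 (I i j)) +ℕ Σ² (λ i j → upper j i *ℕ 𝟙 (I i j))
      ≡⟨ sym (Σ²-+ _ _) ⟩
    Σ² (λ i j → upper i j *ℕ 𝟙 (I i j) +ℕ upper j i *ℕ 𝟙 (I i j))
      ≡⟨ Σ²-cong (λ i j → trans (sym (ℕₚ.*-distribʳ-+ (𝟙 (I i j)) (upper i j) (upper j i)))
                               (counted-once i j)) ⟩
    Σ² (λ i j → 𝟙 (I i j))
      ≡⟨ sym (setSize-Σ² I) ⟩
    setSize I ∎
    where
    open ≡-Reasoning
    counted-once : ∀ i j → (upper i j +ℕ upper j i) *ℕ 𝟙 (I i j) ≡ 𝟙 (I i j)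
    counted-once i j with I i j in e
    ... | false = ℕₚ.*-zeroʳ (upper i j +ℕ upper j i)
    ... | true  = trans (ℕₚ.*-identityʳ _)
      (<ᵇ-exactly-one (toℕ i) (toℕ j) (λ i≡j → not-¬ {I i j} e
        (trans (cong (I i) (sym (toℕ-injective i≡j))) (irr i))))

IsGraph : ∀ {n} → Graph n → Set
IsGraph G = (∀ i j → G i j ≡ G j i) × (∀ i → G i i ≡ false)

TriangleFree : ∀ {n} → Graph n → Set
TriangleFree G = ∀ i j k → G i j ≡ true → G j k ≡ true → G i k ≡ true → ⊥

InducedOn : ∀ {n} → (Fin n → Bool) → Graph n → Graph n → Set
InducedOn P G S = ∀ i j → P i ≡ true → P j ≡ true → G i j ≡ S i j

InA×B : ∀ {n} → (Fin n → Bool) → Graph n → Set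
InA×B A I = ∀ a b → I a b ≡ true → A a ≡ true × A b ≡ false

IndependentIn□ : ∀ {n} → Graph n → Graph n → Graph n → Set
IndependentIn□ S T I =
    (∀ a b b' → I a b ≡ true → I a b' ≡ true → T b b' ≡ true → ⊥)
  × (∀ a a' b → I a b ≡ true → I a' b ≡ true → S a a' ≡ true → ⊥)

isGraphᵇ⁻ : ∀ {n} {G : Graph n} → isGraphᵇ G ≡ true → IsGraph G
isGraphᵇ⁻ e = (λ i j → ==⇒≡ (proj₁ (∧-true⁻ (allB²⁻ _ e i j))))
            , (λ i → not-injective (proj₂ (∧-true⁻ (allB²⁻ _ e i i))))

isGraphᵇ⁺ : ∀ {n} {G : Graph n} → IsGraph G → isGraphᵇ G ≡ true
isGraphᵇ⁺ (G-sym , G-irr) = allB²⁺ _ (λ i j → ∧-true⁺ (≡⇒== (G-sym i j)) (cong not (G-irr i)))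

triangleFreeᵇ⁻ : ∀ {n} {G : Graph n} → triangleFreeᵇ G ≡ true → TriangleFree G
triangleFreeᵇ⁻ e i j k = nand³⁻ (allB³⁻ _ e i j k)

triangleFreeᵇ⁺ : ∀ {n} {G : Graph n} → TriangleFree G → triangleFreeᵇ G ≡ true
triangleFreeᵇ⁺ tf = allB³⁺ _ (λ i j k → nand³⁺ (tf i j k))

inducedEqᵇ⁻ : ∀ {n} {P : Fin n → Bool} {G S : Graph n} → inducedEqᵇ P G S ≡ true → InducedOn P G S
inducedEqᵇ⁻ e i j Pi Pj = ==⇒≡ (not-∨⁻ (allB²⁻ _ e i j) (∧-true⁺ Pi Pj))

inducedEqᵇ⁺ : ∀ {n} {P : Fin n → Bool} {G S : Graph n} → InducedOn P G S → inducedEqᵇ P G S ≡ true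
inducedEqᵇ⁺ ind =
  allB²⁺ _ (λ i j → not-∨⁺ (λ Pij → ≡⇒== (ind i j (proj₁ (∧-true⁻ Pij)) (proj₂ (∧-true⁻ Pij)))))

inABᵇ⁻ : ∀ {n} {A : Fin n → Bool} {I : Graph n} → inABᵇ A I ≡ true → InA×B A I
inABᵇ⁻ e a b Iab with ∧-true⁻ (not-∨⁻ (allB²⁻ _ e a b) Iab)
... | Aa , notAb = Aa , not-injective notAb

inABᵇ⁺ : ∀ {n} {A : Fin n → Bool} {I : Graph n} → InA×B A I → inABᵇ A I ≡ true
inABᵇ⁺ w =
  allB²⁺ _ (λ a b → not-∨⁺ (λ Iab → ∧-true⁺ (proj₁ (w a b Iab)) (cong not (proj₂ (w a b Iab)))))

independentBoxᵇ⁻ : ∀ {n} {S T I : Graph n} → independentBoxᵇ S T I ≡ true → IndependentIn□ S T I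
independentBoxᵇ⁻ e with ∧-true⁻ e
... | e₁ , e₂ = (λ a b b' → nand³⁻ (allB³⁻ _ e₁ a b b'))
              , (λ a a' b → nand³⁻ (allB³⁻ _ e₂ a a' b))

independentBoxᵇ⁺ : ∀ {n} {S T I : Graph n} → IndependentIn□ S T I → independentBoxᵇ S T I ≡ true
independentBoxᵇ⁺ (ind₁ , ind₂) =
  ∧-true⁺ (allB³⁺ _ (λ a b b' → nand³⁺ (ind₁ a b b')))
          (allB³⁺ _ (λ a a' b → nand³⁺ (ind₂ a a' b)))

TriangleFree-⊆ : ∀ {n} {G H : Graph n}
  → (∀ i j → G i j ≡ true → H i j ≡ true) → TriangleFree H → TriangleFree G
TriangleFree-⊆ G⊆H tf i j k gij gjk gik = tf i j k (G⊆H i j gij) (G⊆H j k gjk) (G⊆H i k gik)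

∨-true-introˡ : ∀ {a} b → a ≡ true → a ∨ b ≡ true
∨-true-introˡ b refl = refl

∨-true-introʳ : ∀ a {b} → b ≡ true → a ∨ b ≡ true
∨-true-introʳ true  _ = refl
∨-true-introʳ false e = e

true-or-false : ∀ b → b ≡ true ⊎ b ≡ false
true-or-false true  = inj₁ refl
true-or-false false = inj₂ refl

InA×B-irreflexive : ∀ {n} {A : Fin n → Bool} {I : Graph n} → InA×B A I → ∀ i → I i i ≡ false
InA×B-irreflexive w i = ¬-not (λ Iii → not-¬ (proj₁ (w i i Iii)) (proj₂ (w i i Iii)))

module Correspondence {n : ℕ} (A : Fin n → Bool) (S T : Graph n)
  (S-graph : IsGraph S) (T-graph : IsGraph T)
  (S⊆A : ∀ i j → S i j ≡ true → A i ≡ true × A j ≡ true)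
  (T⊆B : ∀ i j → T i j ≡ true → A i ≡ false × A j ≡ false)
  (S-tf : TriangleFree S) (T-tf : TriangleFree T) where

  𝒢 : Graph n → Set
  𝒢 G = IsGraph G × TriangleFree G × InducedOn A G S × InducedOn (not ∘ A) G T

  ℐ : Graph n → Set
  ℐ I = InA×B A I × IndependentIn□ S T I

  𝒢ᵇ : Graph n → Bool
  𝒢ᵇ G = isGraphᵇ G ∧ triangleFreeᵇ G ∧ inducedEqᵇ A G S ∧ inducedEqᵇ (λ i → not (A i)) G T

  ℐᵇ : Graph n → Bool
  ℐᵇ I = inABᵇ A I ∧ independentBoxᵇ S T I

  𝒢ᵇ⁻ : ∀ {G} → 𝒢ᵇ G ≡ true → 𝒢 G
  𝒢ᵇ⁻ e with ∧-true⁻ e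
  ... | e₁ , e' with ∧-true⁻ e'
  ... | e₂ , e'' with ∧-true⁻ e''
  ... | e₃ , e₄ = isGraphᵇ⁻ e₁ , triangleFreeᵇ⁻ e₂ , inducedEqᵇ⁻ e₃ , inducedEqᵇ⁻ e₄

  𝒢ᵇ⁺ : ∀ {G} → 𝒢 G → 𝒢ᵇ G ≡ true
  𝒢ᵇ⁺ {G} (g , tf , indA , indB) =
    ∧-true⁺ (isGraphᵇ⁺ {G = G} g)
      (∧-true⁺ (triangleFreeᵇ⁺ tf) (∧-true⁺ (inducedEqᵇ⁺ indA) (inducedEqᵇ⁺ indB)))

  ℐᵇ⁻ : ∀ {I} → ℐᵇ I ≡ true → ℐ I
  ℐᵇ⁻ {I} e with ∧-true⁻ {inABᵇ A I} e
  ... | e₁ , e₂ = inABᵇ⁻ e₁ , independentBoxᵇ⁻ e₂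

  ℐᵇ⁺ : ∀ {I} → ℐ I → ℐᵇ I ≡ true
  ℐᵇ⁺ (w , ind) = ∧-true⁺ (inABᵇ⁺ w) (independentBoxᵇ⁺ ind)

  𝒢-resp : ∀ {G H} → (∀ i j → G i j ≡ H i j) → 𝒢 G → 𝒢 H
  𝒢-resp h ((G-sym , G-irr) , tf , indA , indB) =
      ((λ i j → trans (sym (h i j)) (trans (G-sym i j) (h j i))) , (λ i → trans (sym (h i i)) (G-irr i)))
    , (λ i j k a b c → tf i j k (trans (h i j) a) (trans (h j k) b) (trans (h i k) c))
    , (λ i j Pi Pj → trans (sym (h i j)) (indA i j Pi Pj))
    , (λ i j Pi Pj → trans (sym (h i j)) (indB i j Pi Pj))

  ℐ-resp : ∀ {I J} → (∀ a b → I a b ≡ J a b) → ℐ I → ℐ J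
  ℐ-resp h (w , ind₁ , ind₂) =
      (λ a b e → w a b (trans (h a b) e))
    , (λ a b b' x y z → ind₁ a b b' (trans (h a b) x) (trans (h a b') y) z)
    , (λ a a' b x y z → ind₂ a a' b (trans (h a b) x) (trans (h a' b) y) z)

  glue : Graph n → Graph n
  glue I i j = S i j ∨ T i j ∨ I i j ∨ I j i

  crossing : Graph n → Graph n
  crossing G a b = A a ∧ not (A b) ∧ G a b

  crossing-AB : ∀ G {a b} → A a ≡ true → A b ≡ false → crossing G a b ≡ G a b
  crossing-AB G {a} {b} Aa Ab = cong₂ (λ x y → x ∧ not y ∧ G a b) Aa Ab

  crossing-InA×B : ∀ G → InA×B A (crossing G)
  crossing-InA×B G a b e with ∧-true⁻ {A a} e
  ... | Aa , e' = Aa , not-injective (proj₁ (∧-true⁻ e'))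

  S-offˡ : ∀ i j → A i ≡ false → S i j ≡ false
  S-offˡ i j Ai = ¬-not (λ Sij → not-¬ (proj₁ (S⊆A i j Sij)) Ai)

  S-offʳ : ∀ i j → A j ≡ false → S i j ≡ false
  S-offʳ i j Aj = ¬-not (λ Sij → not-¬ (proj₂ (S⊆A i j Sij)) Aj)

  T-offˡ : ∀ i j → A i ≡ true → T i j ≡ false
  T-offˡ i j Ai = ¬-not (λ Tij → not-¬ Ai (proj₁ (T⊆B i j Tij)))

  T-offʳ : ∀ i j → A j ≡ true → T i j ≡ false
  T-offʳ i j Aj = ¬-not (λ Tij → not-¬ Aj (proj₂ (T⊆B i j Tij)))

  module _ {I : Graph n} (I⊆A×B : InA×B A I) where
    I-offˡ : ∀ a b → A a ≡ false → I a b ≡ false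
    I-offˡ a b Aa = ¬-not (λ Iab → not-¬ (proj₁ (I⊆A×B a b Iab)) Aa)

    I-offʳ : ∀ a b → A b ≡ true → I a b ≡ false
    I-offʳ a b Ab = ¬-not (λ Iab → not-¬ Ab (proj₂ (I⊆A×B a b Iab)))

    glue-AA : ∀ {i j} → A i ≡ true → A j ≡ true → glue I i j ≡ S i j
    glue-AA {i} {j} Ai Aj rewrite T-offˡ i j Ai | I-offʳ i j Aj | I-offʳ j i Ai = ∨-identityʳ (S i j)

    glue-AB : ∀ {i j} → A i ≡ true → A j ≡ false → glue I i j ≡ I i j
    glue-AB {i} {j} Ai Aj rewrite S-offʳ i j Aj | T-offˡ i j Ai | I-offˡ j i Aj = ∨-identityʳ (I i j)

    glue-BA : ∀ {i j} → A i ≡ false → A j ≡ true → glue I i j ≡ I j i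
    glue-BA {i} {j} Ai Aj rewrite S-offˡ i j Ai | T-offʳ i j Aj | I-offˡ i j Ai = refl

    glue-BB : ∀ {i j} → A i ≡ false → A j ≡ false → glue I i j ≡ T i j
    glue-BB {i} {j} Ai Aj rewrite S-offˡ i j Ai | I-offˡ i j Ai | I-offˡ j i Aj = ∨-identityʳ (T i j)

    𝟙-glue : ∀ i j → 𝟙 (glue I i j) ≡ 𝟙 (S i j) +ℕ (𝟙 (T i j) +ℕ (𝟙 (I i j) +ℕ 𝟙 (I j i)))
    𝟙-glue i j with A i in Ai | A j in Aj
    ... | true  | true  rewrite glue-AA Ai Aj | T-offˡ i j Ai | I-offʳ i j Aj | I-offʳ j i Ai =
      sym (ℕₚ.+-identityʳ _)
    ... | true  | false rewrite glue-AB Ai Aj | S-offʳ i j Aj | T-offˡ i j Ai | I-offˡ j i Aj =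
      sym (ℕₚ.+-identityʳ _)
    ... | false | true  rewrite glue-BA Ai Aj | S-offˡ i j Ai | T-offʳ i j Aj | I-offˡ i j Ai = refl
    ... | false | false rewrite glue-BB Ai Aj | S-offˡ i j Ai | I-offˡ i j Ai | I-offˡ j i Aj =
      sym (ℕₚ.+-identityʳ _)

    edgeCount-glue : edgeCount (glue I) ≡ edgeCount S +ℕ edgeCount T +ℕ setSize I
    edgeCount-glue = begin
      edgeCount (glue I)
        ≡⟨ edgeCount-Σ² (glue I) ⟩
      Σ² (λ i j → upper i j *ℕ 𝟙 (glue I i j))
        ≡⟨ Σ²-cong (λ i j → trans (cong (upper i j *ℕ_) (𝟙-glue i j)) (distribute (upper i j) _ _ _ _)) ⟩
      Σ² (λ i j → upper i j *ℕ 𝟙 (S i j) +ℕ (upper i j *ℕ 𝟙 (T i j)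
                 +ℕ (upper i j *ℕ 𝟙 (I i j) +ℕ upper i j *ℕ 𝟙 (I j i))))
        ≡⟨ trans (Σ²-+ _ _) (cong (Σ² (λ i j → upper i j *ℕ 𝟙 (S i j)) +ℕ_)
             (trans (Σ²-+ _ _) (cong (Σ² (λ i j → upper i j *ℕ 𝟙 (T i j)) +ℕ_) (Σ²-+ _ _)))) ⟩
      Σ² (λ i j → upper i j *ℕ 𝟙 (S i j)) +ℕ (Σ² (λ i j → upper i j *ℕ 𝟙 (T i j))
        +ℕ (Σ² (λ i j → upper i j *ℕ 𝟙 (I i j)) +ℕ Σ² (λ i j → upper i j *ℕ 𝟙 (I j i))))
        ≡⟨ cong₂ _+ℕ_ (sym (edgeCount-Σ² S))
             (cong₂ _+ℕ_ (sym (edgeCount-Σ² T)) (upper+lower I (InA×B-irreflexive I⊆A×B))) ⟩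
      edgeCount S +ℕ (edgeCount T +ℕ setSize I)
        ≡⟨ sym (ℕₚ.+-assoc (edgeCount S) _ _) ⟩
      edgeCount S +ℕ edgeCount T +ℕ setSize I ∎
      where
      open ≡-Reasoning
      open PairSums n
      distribute : ∀ u a b c d
        → u *ℕ (a +ℕ (b +ℕ (c +ℕ d))) ≡ u *ℕ a +ℕ (u *ℕ b +ℕ (u *ℕ c +ℕ u *ℕ d))
      distribute u a b c d = trans (ℕₚ.*-distribˡ-+ u a _) (cong (u *ℕ a +ℕ_)
        (trans (ℕₚ.*-distribˡ-+ u b _) (cong (u *ℕ b +ℕ_) (ℕₚ.*-distribˡ-+ u c d))))

    crossing-glue : ∀ a b → crossing (glue I) a b ≡ I a b
    crossing-glue a b with A a in Aa | A b in Ab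
    ... | true  | false = glue-AB Aa Ab
    ... | true  | true  = sym (I-offʳ a b Ab)
    ... | false | _     = sym (I-offˡ a b Aa)

  glue-𝒢 : ∀ {I} → ℐ I → 𝒢 (glue I)
  glue-𝒢 {I} (I⊆A×B , ind₁ , ind₂) = (glue-sym , glue-irr) , glue-tf
    , (λ i j → glue-AA I⊆A×B) , (λ i j Bi Bj → glue-BB I⊆A×B (not-injective Bi) (not-injective Bj))
    where
    glue-sym : ∀ i j → glue I i j ≡ glue I j i
    glue-sym i j = cong₂ _∨_ (proj₁ S-graph i j) (cong₂ _∨_ (proj₁ T-graph i j) (∨-comm (I i j) (I j i)))
    glue-irr : ∀ i → glue I i i ≡ false
    glue-irr i rewrite proj₂ S-graph i | proj₂ T-graph i | InA×B-irreflexive I⊆A×B i = refl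
    inS : ∀ {i j} → A i ≡ true → A j ≡ true → glue I i j ≡ true → S i j ≡ true
    inS Ai Aj = trans (sym (glue-AA I⊆A×B Ai Aj))
    inI : ∀ {i j} → A i ≡ true → A j ≡ false → glue I i j ≡ true → I i j ≡ true
    inI Ai Aj = trans (sym (glue-AB I⊆A×B Ai Aj))
    inIᵀ : ∀ {i j} → A i ≡ false → A j ≡ true → glue I i j ≡ true → I j i ≡ true
    inIᵀ Ai Aj = trans (sym (glue-BA I⊆A×B Ai Aj))
    inT : ∀ {i j} → A i ≡ false → A j ≡ false → glue I i j ≡ true → T i j ≡ true
    inT Ai Aj = trans (sym (glue-BB I⊆A×B Ai Aj))
    glue-tf : TriangleFree (glue I)
    glue-tf i j k ij jk ik with A i in Ai | A j in Aj | A k in Ak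
    ... | true  | true  | true  = S-tf i j k (inS Ai Aj ij) (inS Aj Ak jk) (inS Ai Ak ik)
    ... | true  | true  | false = ind₂ i j k (inI Ai Ak ik) (inI Aj Ak jk) (inS Ai Aj ij)
    ... | true  | false | true  = ind₂ i k j (inI Ai Aj ij) (inIᵀ Aj Ak jk) (inS Ai Ak ik)
    ... | false | true  | true  = ind₂ j k i (inIᵀ Ai Aj ij) (inIᵀ Ai Ak ik) (inS Aj Ak jk)
    ... | true  | false | false = ind₁ i j k (inI Ai Aj ij) (inI Ai Ak ik) (inT Aj Ak jk)
    ... | false | true  | false = ind₁ j i k (inIᵀ Ai Aj ij) (inI Aj Ak jk) (inT Ai Ak ik)
    ... | false | false | true  = ind₁ k i j (inIᵀ Ai Ak ik) (inIᵀ Aj Ak jk) (inT Ai Aj ij)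
    ... | false | false | false = T-tf i j k (inT Ai Aj ij) (inT Aj Ak jk) (inT Ai Ak ik)

  module _ {G : Graph n} (G∈𝒢 : 𝒢 G) where
    private
      G-sym = proj₁ (proj₁ G∈𝒢)
      G-tf  = proj₁ (proj₂ G∈𝒢)
      G-onA = proj₁ (proj₂ (proj₂ G∈𝒢))
      G-onB = proj₂ (proj₂ (proj₂ G∈𝒢))

    crossing-ℐ : ℐ (crossing G)
    crossing-ℐ = crossing-InA×B G , ind₁ , ind₂
      where
      edge : ∀ {a b} → crossing G a b ≡ true → G a b ≡ true
      edge {a} {b} e = proj₂ (∧-true⁻ {not (A b)} (proj₂ (∧-true⁻ {A a} e)))
      ind₁ : ∀ a b b' → crossing G a b ≡ true → crossing G a b' ≡ true → T b b' ≡ true → ⊥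
      ind₁ a b b' x y Tbb' = G-tf a b b' (edge x)
        (trans (G-onB b b' (cong not (proj₂ (crossing-InA×B G a b x)))
                           (cong not (proj₂ (crossing-InA×B G a b' y)))) Tbb')
        (edge y)
      ind₂ : ∀ a a' b → crossing G a b ≡ true → crossing G a' b ≡ true → S a a' ≡ true → ⊥
      ind₂ a a' b x y Saa' = G-tf a a' b
        (trans (G-onA a a' (proj₁ (crossing-InA×B G a b x)) (proj₁ (crossing-InA×B G a' b y))) Saa')
        (edge y) (edge x)

    glue-crossing : ∀ i j → glue (crossing G) i j ≡ G i j
    glue-crossing i j with true-or-false (A i) | true-or-false (A j)
    ... | inj₁ Ai | inj₁ Aj = trans (glue-AA (crossing-InA×B G) Ai Aj) (sym (G-onA i j Ai Aj))
    ... | inj₁ Ai | inj₂ Aj = trans (glue-AB (crossing-InA×B G) Ai Aj) (crossing-AB G Ai Aj)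
    ... | inj₂ Ai | inj₁ Aj = trans (glue-BA (crossing-InA×B G) Ai Aj) (trans (crossing-AB G Aj Ai) (G-sym j i))
    ... | inj₂ Ai | inj₂ Aj = trans (glue-BB (crossing-InA×B G) Ai Aj) (sym (G-onB i j (cong not Ai) (cong not Aj)))

  correspondence : ∀ I G → ℐᵇ I ∧ (G ≐ glue I) ≡ 𝒢ᵇ G ∧ (I ≐ crossing G)
  correspondence I G = true⇔true⇒≡ forward backward
    where
    forward : ℐᵇ I ∧ (G ≐ glue I) ≡ true → 𝒢ᵇ G ∧ (I ≐ crossing G) ≡ true
    forward e with ∧-true⁻ {ℐᵇ I} e
    ... | eI , eG = ∧-true⁺ (𝒢ᵇ⁺ (𝒢-resp (λ i j → sym (G≗glue i j)) (glue-𝒢 I∈ℐ)))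
                            (≐⁺ {G = I} {H = crossing G} I≗crossing)
      where
      I∈ℐ = ℐᵇ⁻ eI
      G≗glue = ≐⁻ {G = G} {H = glue I} eG
      I≗crossing : ∀ a b → I a b ≡ crossing G a b
      I≗crossing a b = trans (sym (crossing-glue (proj₁ I∈ℐ) a b))
                             (cong (λ x → A a ∧ not (A b) ∧ x) (sym (G≗glue a b)))
    backward : 𝒢ᵇ G ∧ (I ≐ crossing G) ≡ true → ℐᵇ I ∧ (G ≐ glue I) ≡ true
    backward e with ∧-true⁻ {𝒢ᵇ G} e
    ... | eG , eI = ∧-true⁺ (ℐᵇ⁺ (ℐ-resp (λ a b → sym (I≗crossing a b)) (crossing-ℐ G∈𝒢)))
                            (≐⁺ {G = G} {H = glue I} G≗glue)
      where
      G∈𝒢 = 𝒢ᵇ⁻ eG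
      I≗crossing = ≐⁻ {G = I} {H = crossing G} eI
      G≗glue : ∀ i j → G i j ≡ glue I i j
      G≗glue i j = trans (sym (glue-crossing G∈𝒢 i j))
        (cong₂ (λ x y → S i j ∨ T i j ∨ x ∨ y) (sym (I≗crossing i j)) (sym (I≗crossing j i)))

lemma4p4 : ∀ {c ℓ} (R : CommutativeSemiring c ℓ) (n : ℕ) (A : Fin n → Bool) (S T : Graph n)
    → isGraphᵇ S ≡ true → isGraphᵇ T ≡ true
    → (∀ i j → S i j ≡ true → (A i ≡ true × A j ≡ true))
    → (∀ i j → T i j ≡ true → (not (A i) ≡ true × not (A j) ≡ true))
    → triangleFreeᵇ (S ∪ T) ≡ true
    → (lam : CommutativeSemiring.Carrier R)
    → CommutativeSemiring._≈_ R (graphSum R A S T lam)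
        (CommutativeSemiring._*_ R (pow R lam (edgeCount S +ℕ edgeCount T)) (Zbox R A S T lam))
lemma4p4 R n A S T S-graph T-graph S⊆A T⊆B S∪T-tf lam = begin
    Σ mats (λ G → λ^ (edgeCount G) when 𝒢ᵇ G)
      ≈⟨ Σ-reindex (matrices-enumeration n) (matrices-enumeration n) glue crossing ℐᵇ 𝒢ᵇ correspondence
           (λ G → λ^ (edgeCount G)) (λ e → reflexive (cong λ^ (PairSums.edgeCount-cong n (≐⁻ e)))) ⟩
    Σ mats (λ I → λ^ (edgeCount (glue I)) when ℐᵇ I)
      ≈⟨ Σ-when-cong mats ℐᵇ weight ⟩
    Σ mats (λ I → λ^ (edgeCount S +ℕ edgeCount T) * λ^ (setSize I) when ℐᵇ I)
      ≈⟨ ≈-sym (≈-trans (Σ-*ˡ mats _ _) (Σ-cong mats (λ I → *-when (ℐᵇ I) _ _))) ⟩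
    λ^ (edgeCount S +ℕ edgeCount T) * Σ mats (λ I → λ^ (setSize I) when ℐᵇ I) ∎
  where
  open CommutativeSemiring R using (Carrier; _*_; _≈_; reflexive; setoid) renaming (sym to ≈-sym; trans to ≈-trans)
  open Sums R
  open import Relation.Binary.Reasoning.Setoid setoid
  open Correspondence A S T (isGraphᵇ⁻ S-graph) (isGraphᵇ⁻ T-graph) S⊆A
    (λ i j Tij → not-injective (proj₁ (T⊆B i j Tij)) , not-injective (proj₂ (T⊆B i j Tij)))
    (TriangleFree-⊆ (λ i j → ∨-true-introˡ (T i j)) (triangleFreeᵇ⁻ S∪T-tf))
    (TriangleFree-⊆ (λ i j → ∨-true-introʳ (S i j)) (triangleFreeᵇ⁻ S∪T-tf))
  mats = allMatrices n
  λ^ : ℕ → Carrier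
  λ^ = pow R lam
  weight : ∀ I → ℐᵇ I ≡ true → λ^ (edgeCount (glue I)) ≈ λ^ (edgeCount S +ℕ edgeCount T) * λ^ (setSize I)
  weight I I∈ℐ = ≈-trans (reflexive (cong λ^ (edgeCount-glue (proj₁ (ℐᵇ⁻ I∈ℐ)))))
    (pow-+ lam (edgeCount S +ℕ edgeCount T) (setSize I))
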